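{- Let $\vec G=(V,\vec E)$ be a finite directed graph with bijective successor function $\delta$. Let $r\in\mathbb{N}$ and let $e_1,\ldots,e_r\in\vec E$ with $e_i\equiv_\delta e_j$ for all $i,j\in[r]$. Let $e_1',\ldots,e_r'\in\vec E$ with $e_i'\not\equiv_\delta e_j'$ for all $i\neq j\in[r]$ and $e_i\not\equiv_\delta e_i'$ for all $i\in[r]$. Let $\delta'$ be a successor function on $\vec G$ such that: - $\delta'(e)=\delta(e)$ for every $e\in\vec E\setminus\{e_1,\ldots,e_r,e_1',\ldots,e_r'\}$; - $\delta'(e_i)=\delta(e_i')$ and $\delta'(e_i')=\delta(e_i)$ for every $i\in[r]$. Then $\delta'$ is bijective, and (P1) $[e_1]_{\delta'}=\bigcup_{i=1}^r[e_i']_\delta\cup[e_1]_\delta$; (P2) $[e]_{\delta'}=[e]_\delta$ for every $e\in\vec E\setminus[e_1]_{\delta'}$.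
   Context: For a directed edge $x=(a,b)$, write $x_{(1)}=a$ and $x_{(2)}=b$. A successor function on $\vec G$ is a map $\delta:\vec E\to\vec E$ with $\delta(x)_{(1)}=x_{(2)}$ for all $x\in\vec E$. For $x,x'\in\vec E$, define $x\equiv_\delta x'$ if and only if there is $k\in\mathbb{N}=\{1,2,\ldots\}$ with $\delta^k(x)=x'$, where $\delta^k$ is the $k$-fold composition of $\delta$. For bijective $\delta$ this is an equivalence relation, and $[e]_\delta$ denotes the class of $e$. -}

module Defs where

open import Data.Nat using (ℕ; zero; suc; _≤_)
open import Data.Fin using (Fin)
open import Data.Product using (_×_; proj₁; proj₂; Σ-syntax)
open import Relation.Binary.PropositionalEquality using (_≡_)
open import Function.Definitions using (Injective)

record Digraph : Set where
  field
    nV   : ℕ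
    nE   : ℕ
    edge : Fin nE → Fin nV × Fin nV
    edge-inj : Injective _≡_ _≡_ edge

  Vtx : Set
  Vtx = Fin nV

  Edge : Set
  Edge = Fin nE

  fst : Edge → Vtx
  fst x = proj₁ (edge x)

  snd : Edge → Vtx
  snd x = proj₂ (edge x)

open Digraph public

IsSuccessor : (G : Digraph) → (Edge G → Edge G) → Set
IsSuccessor G δ = ∀ x → fst G (δ x) ≡ snd G x

iter : {A : Set} → (A → A) → ℕ → A → A
iter f zero    x = x
iter f (suc k) x = f (iter f k x)

_≡[_]_ : {A : Set} → A → (A → A) → A → Set
x ≡[ δ ] x' = Σ[ k ∈ ℕ ] (1 ≤ k × iter δ k x ≡ x')

Class : {A : Set} → (A → A) → A → A → Set
Class δ e x = e ≡[ δ ] x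

-- δ′ is δ precomposed with the involution swapping each e i with e′ i, hence a permutation.
-- Following δ′ from e i one walks the δ-cycle of e i, and at each e j detours once around the
-- δ-cycle of e′ j (which contains no other e k or e′ k) before returning to δ (e j); so the
-- δ′-cycle of e i is the union of these δ-cycles.  That union is invariant under δ and its
-- inverse, and δ′ agrees with δ off it, so every other cycle is left unchanged.
module Submission where

open import Defs
open import Data.Nat using (ℕ; zero; suc; _+_; _∸_; s≤s; z≤n)
open import Data.Nat.Properties using (n<1+n; m<n⇒0<n∸m; m+[n∸m]≡n; <⇒≤)
open import Data.Fin using (Fin; zero; toℕ)
open import Data.Fin.Properties using (pigeonhole; any?; _≟_)
open import Data.Product using (_×_; Σ-syntax; _,_; proj₁; proj₂)
open import Data.Sum using (_⊎_; inj₁; inj₂)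
open import Data.Empty using (⊥-elim)
open import Relation.Nullary using (¬_; yes; no)
open import Relation.Binary.Definitions using (DecidableEquality)
open import Relation.Binary.PropositionalEquality
  using (_≡_; _≢_; refl; sym; trans; cong; subst; module ≡-Reasoning)
open import Function.Definitions using (Injective; Bijective)
open import Function.Bundles using (_⇔_; mk⇔)

module Orbit {A : Set} (f : A → A) where

  iter-+ : ∀ m n x → iter f (m + n) x ≡ iter f m (iter f n x)
  iter-+ zero    n x = refl
  iter-+ (suc m) n x = cong f (iter-+ m n x)

  iter-suc : ∀ k x → iter f k (f x) ≡ iter f (suc k) x
  iter-suc zero    x = refl
  iter-suc (suc k) x = cong f (iter-suc k x)

  Class-step : ∀ {a x} → Class f a x → Class f a (f x)
  Class-step (k , _ , p) = suc k , s≤s z≤n , cong f p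

  Class-trans : ∀ {a b c} → Class f a b → Class f b c → Class f a c
  Class-trans {a} (k , _ , p) (suc l , _ , q) = suc l + k , s≤s z≤n ,
    trans (iter-+ (suc l) k a) (trans (cong (iter f (suc l)) p) q)

  Class-induction : DecidableEquality A → ∀ {a} (P : A → Set) → P (f a) →
                    (∀ {y} → Class f a y → y ≢ a → P y → P (f y)) →
                    ∀ {x} → Class f a x → P x
  Class-induction _≟_ {a} P base step (suc k , _ , refl) = subst P (iter-suc k a) (along k)
    where
      along : ∀ k → P (iter f k (f a))
      along zero = base
      along (suc k) with iter f k (f a) ≟ a
      ... | yes y≡a = subst P (cong f (sym y≡a)) base
      ... | no y≢a  = step (suc k , s≤s z≤n , sym (iter-suc k a)) y≢a (along k)

  iter-agree : ∀ {g} (P : A → Set) → (∀ {x} → P x → P (f x)) → (∀ {x} → P x → g x ≡ f x) →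
               ∀ {y} → P y → ∀ k → P (iter f k y) × iter g k y ≡ iter f k y
  iter-agree P P-closed g≡f Py zero = Py , refl
  iter-agree {g} P P-closed g≡f Py (suc k) with iter-agree P P-closed g≡f Py k
  ... | Pk , eq = P-closed Pk , trans (cong g eq) (g≡f Pk)

  Class-⇔-on-invariant : ∀ {g} (P : A → Set) → (∀ {x} → P x → P (f x)) →
                         (∀ {x} → P x → g x ≡ f x) →
                         ∀ {y} → P y → ∀ x → Class g y x ⇔ Class f y x
  Class-⇔-on-invariant {g} P P-closed g≡f {y} Py x = mk⇔
    (λ (k , 1≤k , p) → k , 1≤k , trans (sym (agree k)) p)
    (λ (k , 1≤k , p) → k , 1≤k , trans (agree k) p)
    where
      agree : ∀ k → iter g k y ≡ iter f k y
      agree k = proj₂ (iter-agree P P-closed g≡f Py k)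

module FiniteInjection {n : ℕ} (f : Fin n → Fin n) (f-injective : Injective _≡_ _≡_ f) where

  open Orbit f public

  iter-injective : ∀ k → Injective _≡_ _≡_ (iter f k)
  iter-injective zero    p = p
  iter-injective (suc k) p = iter-injective k (f-injective p)

  -- Pigeonhole on a, f a, …, fⁿ a gives fⁱ a ≡ fʲ a with i < j; cancelling fⁱ leaves a ≡ fʲ⁻ⁱ a.
  Class-refl : ∀ a → Class f a a
  Class-refl a with pigeonhole (n<1+n n) (λ k → iter f (toℕ k) a)
  ... | i , j , i<j , fⁱa≡fʲa = toℕ j ∸ toℕ i , m<n⇒0<n∸m i<j , sym (iter-injective (toℕ i) shifted)
    where
      open ≡-Reasoning
      shifted : iter f (toℕ i) a ≡ iter f (toℕ i) (iter f (toℕ j ∸ toℕ i) a)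
      shifted = begin
        iter f (toℕ i) a                             ≡⟨ fⁱa≡fʲa ⟩
        iter f (toℕ j) a                             ≡⟨ cong (λ t → iter f t a) (m+[n∸m]≡n (<⇒≤ i<j)) ⟨
        iter f (toℕ i + (toℕ j ∸ toℕ i)) a           ≡⟨ iter-+ (toℕ i) (toℕ j ∸ toℕ i) a ⟩
        iter f (toℕ i) (iter f (toℕ j ∸ toℕ i) a)    ∎

  Class-pred : ∀ {a z} → Class f a (f z) → Class f a z
  Class-pred {a} (suc zero    , _ , p) = subst (Class f a) (f-injective p) (Class-refl a)
  Class-pred     (suc (suc k) , _ , p) = suc k , s≤s z≤n , f-injective p

  Class-pred-iter : ∀ k {a z} → Class f a (iter f k z) → Class f a z
  Class-pred-iter zero    c = c
  Class-pred-iter (suc k) c = Class-pred-iter k (Class-pred c)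

  Class-sym : ∀ {a b} → Class f a b → Class f b a
  Class-sym {b = b} (k , _ , p) = Class-pred-iter k (subst (Class f b) (sym p) (Class-refl b))

bijective-via-involution : ∀ {A : Set} {f g τ : A → A} → Bijective _≡_ _≡_ f →
                           (∀ x → τ (τ x) ≡ x) → (∀ x → g x ≡ f (τ x)) → Bijective _≡_ _≡_ g
bijective-via-involution {f = f} {g} {τ} (f-injective , f-surjective) τ-involutive g≡fτ =
  injective , surjective
  where
    open ≡-Reasoning
    injective : Injective _≡_ _≡_ g
    injective {x} {y} gx≡gy = begin
      x         ≡⟨ τ-involutive x ⟨
      τ (τ x)   ≡⟨ cong τ (f-injective (trans (sym (g≡fτ x)) (trans gx≡gy (g≡fτ y)))) ⟩
      τ (τ y)   ≡⟨ τ-involutive y ⟩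
      y         ∎
    surjective : ∀ y → Σ[ x ∈ _ ] (∀ {z} → z ≡ x → g z ≡ y)
    surjective y with f-surjective y
    ... | w , fw≡y = τ w , λ {z} z≡τw → trans (g≡fτ z) (fw≡y (trans (cong τ z≡τw) (τ-involutive w)))

module Switch {n m : ℕ} (δ : Fin n → Fin n) (δ-bijective : Bijective _≡_ _≡_ δ)
  (e e′ : Fin m → Fin n)
  (e-linked : ∀ i j → e i ≡[ δ ] e j)
  (e′-apart : ∀ i j → i ≢ j → ¬ (e′ i ≡[ δ ] e′ j))
  (e-e′-apart : ∀ i → ¬ (e i ≡[ δ ] e′ i))
  (δ′ : Fin n → Fin n)
  (δ′-outside : ∀ x → (∀ i → x ≢ e i) → (∀ i → x ≢ e′ i) → δ′ x ≡ δ x)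
  (δ′-e : ∀ i → δ′ (e i) ≡ δ (e′ i))
  (δ′-e′ : ∀ i → δ′ (e′ i) ≡ δ (e i)) where

  open FiniteInjection δ (proj₁ δ-bijective)

  e-e′-apart-any : ∀ i j → ¬ (e i ≡[ δ ] e′ j)
  e-e′-apart-any i j c = e-e′-apart j (Class-trans (e-linked j i) c)

  e≢e′ : ∀ i j → e i ≢ e′ j
  e≢e′ i j p = e-e′-apart-any i j (subst (Class δ (e i)) p (Class-refl (e i)))

  e′-injective : Injective _≡_ _≡_ e′
  e′-injective {i} {j} p with i ≟ j
  ... | yes i≡j = i≡j
  ... | no i≢j  = ⊥-elim (e′-apart i j i≢j (subst (Class δ (e′ i)) p (Class-refl (e′ i))))

  e-injective : Injective _≡_ _≡_ e
  e-injective {i} {j} p = e′-injective (proj₁ δ-bijective (trans (sym (δ′-e i)) (trans (cong δ′ p) (δ′-e j))))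

  data Position (x : Fin n) : Set where
    at-e      : ∀ i → x ≡ e i → Position x
    at-e′     : ∀ i → x ≡ e′ i → Position x
    elsewhere : (∀ i → x ≢ e i) → (∀ i → x ≢ e′ i) → Position x

  position : ∀ x → Position x
  position x with any? (λ i → x ≟ e i)
  ... | yes (i , p) = at-e i p
  ... | no ¬e with any? (λ i → x ≟ e′ i)
  ... | yes (i , p) = at-e′ i p
  ... | no ¬e′ = elsewhere (λ i p → ¬e (i , p)) (λ i p → ¬e′ (i , p))

  swap : Fin n → Fin n
  swap x with position x
  ... | at-e i _      = e′ i
  ... | at-e′ i _     = e i
  ... | elsewhere _ _ = x

  swap-e : ∀ i → swap (e i) ≡ e′ i
  swap-e i with position (e i)
  ... | at-e j p      = cong e′ (e-injective (sym p))
  ... | at-e′ j p     = ⊥-elim (e≢e′ i j p)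
  ... | elsewhere ¬e _ = ⊥-elim (¬e i refl)

  swap-e′ : ∀ i → swap (e′ i) ≡ e i
  swap-e′ i with position (e′ i)
  ... | at-e j p       = ⊥-elim (e≢e′ j i (sym p))
  ... | at-e′ j p      = cong e (e′-injective (sym p))
  ... | elsewhere _ ¬e′ = ⊥-elim (¬e′ i refl)

  swap-elsewhere : ∀ {x} → (∀ i → x ≢ e i) → (∀ i → x ≢ e′ i) → swap x ≡ x
  swap-elsewhere {x} ¬e ¬e′ with position x
  ... | at-e i p      = ⊥-elim (¬e i p)
  ... | at-e′ i p     = ⊥-elim (¬e′ i p)
  ... | elsewhere _ _ = refl

  swap-involutive : ∀ x → swap (swap x) ≡ x
  swap-involutive x = at (position x)
    where
      at : Position x → swap (swap x) ≡ x
      at (at-e i refl)      = trans (cong swap (swap-e i)) (swap-e′ i)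
      at (at-e′ i refl)     = trans (cong swap (swap-e′ i)) (swap-e i)
      at (elsewhere ¬e ¬e′) = trans (cong swap (swap-elsewhere ¬e ¬e′)) (swap-elsewhere ¬e ¬e′)

  δ′≡δ∘swap : ∀ x → δ′ x ≡ δ (swap x)
  δ′≡δ∘swap x = at (position x)
    where
      at : Position x → δ′ x ≡ δ (swap x)
      at (at-e i refl)      = trans (δ′-e i) (cong δ (sym (swap-e i)))
      at (at-e′ i refl)     = trans (δ′-e′ i) (cong δ (sym (swap-e′ i)))
      at (elsewhere ¬e ¬e′) = trans (δ′-outside x ¬e ¬e′) (cong δ (sym (swap-elsewhere ¬e ¬e′)))

  δ′-bijective : Bijective _≡_ _≡_ δ′
  δ′-bijective = bijective-via-involution δ-bijective swap-involutive δ′≡δ∘swap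

  module Orbit′ = FiniteInjection δ′ (proj₁ δ′-bijective)

  Merged : Fin m → Fin n → Set
  Merged i x = (Σ[ j ∈ Fin m ] Class δ (e′ j) x) ⊎ Class δ (e i) x

  Merged-δ-closed : ∀ {i x} → Merged i x → Merged i (δ x)
  Merged-δ-closed (inj₁ (j , c)) = inj₁ (j , Class-step c)
  Merged-δ-closed (inj₂ c)       = inj₂ (Class-step c)

  Merged-δ-pred : ∀ {i x} → Merged i (δ x) → Merged i x
  Merged-δ-pred (inj₁ (j , c)) = inj₁ (j , Class-pred c)
  Merged-δ-pred (inj₂ c)       = inj₂ (Class-pred c)

  Merged-δ′-closed : ∀ i {x} → Merged i x → Merged i (δ′ x)
  Merged-δ′-closed i {x} mx with position x
  ... | at-e j refl      = subst (Merged i) (sym (δ′-e j)) (inj₁ (j , 1 , s≤s z≤n , refl))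
  ... | at-e′ j refl     = subst (Merged i) (sym (δ′-e′ j)) (inj₂ (Class-step (e-linked i j)))
  ... | elsewhere ¬e ¬e′ = subst (Merged i) (sym (δ′-outside x ¬e ¬e′)) (Merged-δ-closed mx)

  class⊆Merged : ∀ i {x} → Class δ′ (e i) x → Merged i x
  class⊆Merged i = Orbit′.Class-induction _≟_ (Merged i)
    (Merged-δ′-closed i (inj₂ (Class-refl (e i)))) (λ _ _ → Merged-δ′-closed i)

  δ′-agrees-on-e′-orbit : ∀ j {y} → Class δ (e′ j) y → y ≢ e′ j → δ′ y ≡ δ y
  δ′-agrees-on-e′-orbit j {y} c y≢e′j = δ′-outside y ≢e ≢e′
    where
      ≢e : ∀ k → y ≢ e k
      ≢e k y≡ek = e-e′-apart-any k j (Class-sym (subst (Class δ (e′ j)) y≡ek c))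
      ≢e′ : ∀ k → y ≢ e′ k
      ≢e′ k y≡e′k with j ≟ k
      ... | yes refl = y≢e′j y≡e′k
      ... | no j≢k   = e′-apart j k j≢k (subst (Class δ (e′ j)) y≡e′k c)

  e′-orbit-reached : ∀ j {c} → Class δ′ c (e j) → ∀ {x} → Class δ (e′ j) x → Class δ′ c x
  e′-orbit-reached j {c} c→ej = Class-induction _≟_ (Class δ′ c)
    (subst (Class δ′ c) (δ′-e j) (Orbit′.Class-step c→ej))
    (λ y∈ y≢e′j c→y → subst (Class δ′ c) (δ′-agrees-on-e′-orbit j y∈ y≢e′j) (Orbit′.Class-step c→y))

  δ-e-reached : ∀ j {c} → Class δ′ c (e j) → Class δ′ c (δ (e j))
  δ-e-reached j c→ej =
    subst (Class δ′ _) (δ′-e′ j) (Orbit′.Class-step (e′-orbit-reached j c→ej (Class-refl (e′ j))))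

  e-orbit-reached : ∀ i {x} → Class δ (e i) x → Class δ′ (e i) x
  e-orbit-reached i = Class-induction _≟_ (Class δ′ (e i))
    (δ-e-reached i (Orbit′.Class-refl (e i))) step
    where
      step : ∀ {y} → Class δ (e i) y → y ≢ e i → Class δ′ (e i) y → Class δ′ (e i) (δ y)
      step {y} ei→y _ ei→′y with position y
      ... | at-e j refl      = δ-e-reached j ei→′y
      ... | at-e′ j refl     = ⊥-elim (e-e′-apart-any i j ei→y)
      ... | elsewhere ¬e ¬e′ = subst (Class δ′ (e i)) (δ′-outside y ¬e ¬e′) (Orbit′.Class-step ei→′y)

  Merged⊆class : ∀ i {x} → Merged i x → Class δ′ (e i) x
  Merged⊆class i (inj₁ (j , c)) = e′-orbit-reached j (e-orbit-reached i (e-linked i j)) c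
  Merged⊆class i (inj₂ c)       = e-orbit-reached i c

  class⇔Merged : ∀ i x → Class δ′ (e i) x ⇔ Merged i x
  class⇔Merged i x = mk⇔ (class⊆Merged i) (Merged⊆class i)

  δ′-agrees-off-Merged : ∀ i {x} → ¬ Merged i x → δ′ x ≡ δ x
  δ′-agrees-off-Merged i {x} x∉ = δ′-outside x
    (λ k x≡ek → x∉ (inj₂ (subst (Class δ (e i)) (sym x≡ek) (e-linked i k))))
    (λ k x≡e′k → x∉ (inj₁ (k , subst (Class δ (e′ k)) (sym x≡e′k) (Class-refl (e′ k)))))

  class-unchanged : ∀ i y → ¬ Class δ′ (e i) y → ∀ x → Class δ′ y x ⇔ Class δ y x
  class-unchanged i y y∉ = Class-⇔-on-invariant (λ x → ¬ Merged i x)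
    (λ x∉ δx∈ → x∉ (Merged-δ-pred δx∈)) (δ′-agrees-off-Merged i) (λ y∈ → y∉ (Merged⊆class i y∈))

lemma7 : (G : Digraph) (δ : Edge G → Edge G) → IsSuccessor G δ → Bijective _≡_ _≡_ δ →
         (r : ℕ) (e e′ : Fin (suc r) → Edge G) →
         (∀ i j → e i ≡[ δ ] e j) →
         (∀ i j → i ≢ j → ¬ (e′ i ≡[ δ ] e′ j)) →
         (∀ i → ¬ (e i ≡[ δ ] e′ i)) →
         (δ′ : Edge G → Edge G) → IsSuccessor G δ′ →
         (∀ x → (∀ i → x ≢ e i) → (∀ i → x ≢ e′ i) → δ′ x ≡ δ x) →
         (∀ i → δ′ (e i) ≡ δ (e′ i)) →
         (∀ i → δ′ (e′ i) ≡ δ (e i)) →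
         Bijective _≡_ _≡_ δ′
         × (∀ x → Class δ′ (e zero) x ⇔ ((Σ[ i ∈ Fin (suc r) ] Class δ (e′ i) x) ⊎ Class δ (e zero) x))
         × (∀ y → ¬ Class δ′ (e zero) y → ∀ x → Class δ′ y x ⇔ Class δ y x)
lemma7 G δ _ δ-bijective r e e′ e-linked e′-apart e-e′-apart δ′ _ δ′-outside δ′-e δ′-e′ =
  δ′-bijective , class⇔Merged zero , class-unchanged zero
  where open Switch δ δ-bijective e e′ e-linked e′-apart e-e′-apart δ′ δ′-outside δ′-e δ′-e′
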